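{- Let $n,d$ be integers with $d\ge1$ and $n\ge d+2$, and let $G\in\mathcal{K}_{n,d}$ be such that $\{i_1,j_1\}\notin E(G)$ and $\{i_2,j_2\}\notin E(G)$ for all distinct $i,j\in D(G)$. Then the inequality $\sum_{v\in V(G)}x_v\le d+1$, which is valid for $\mathrm{STAB}(G)$, has $\mathrm{CG}$-rank at least $\log_4\!\left(\frac{3d-1}{2}\right)$.
   Context: Stretched cliques: stretching a vertex $v$ of a graph with sets $A_1,\dots,A_m\subseteq\Gamma(v)$ (possibly empty, union equal to the neighborhood $\Gamma(v)$) replaces $v$ by new vertices $v_0,\dots,v_m$, joining each $v_j$ ($j\in[m]$) to $v_0$ and to all vertices of $A_j$; $m=2$ gives a 2-stretching. $\mathcal{K}_{n,d}$ is the set of graphs obtained from $K_n$ (vertex set $[n]$) by 2-stretching $d$ of its original vertices, each at most once. For $G\in\mathcal{K}_{n,d}$, $D(G)$ is the set of stretched original vertices; for $i\in D(G)$, the vertices created are $i_0$ (the hub, playing the role of $v_0$) and the wings $i_1,i_2$ (playing the roles of $v_1,v_2$). Chvátal–Gomory closure: for $P\subseteq[0,1]^n$, if $a^\top x\le\beta$ is valid for $P$ with $a\in\mathbb{Z}^n$, then $a^\top x\le\lfloor\beta\rfloor$ is a Chvátal–Gomory cut; $\mathrm{CG}(P)$ is the set of points satisfying all Chvátal–Gomory cuts of $P$, $\mathrm{CG}^1=\mathrm{CG}$, $\mathrm{CG}^\ell(P)=\mathrm{CG}(\mathrm{CG}^{\ell-1}(P))$. The $\mathrm{CG}$-rank of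 an inequality valid for $\mathrm{STAB}(G)$ is the least $\ell$ such that it is valid for $\mathrm{CG}^\ell(\mathrm{FRAC}(G))$ (with $\mathrm{CG}^0(P)=P$), where $\mathrm{FRAC}(G)=\{x\in[0,1]^{V(G)}:x_i+x_j\le1\ \forall\{i,j\}\in E(G)\}$ and $\mathrm{STAB}(G)$ is the convex hull of incidence vectors of stable sets of $G$.
   Formalization: Points of $\mathrm{FRAC}(G)$ and of its Chvátal–Gomory closures have rational coordinates, and the right-hand sides $\beta$ of the valid inequalities giving Chvátal–Gomory cuts are rational. -}

module Defs where

open import Data.Nat using (ℕ; zero; suc)
open import Data.Fin using (Fin; toℕ)
open import Data.Integer using (ℤ)
open import Data.Rational using (ℚ; 0ℚ; 1ℚ; _+_; _*_; _≤_; _/_; floor)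
open import Data.Product using (Σ; _×_)
open import Data.Sum using (_⊎_; inj₁; inj₂)
open import Data.Empty using (⊥)
open import Relation.Nullary using (¬_)
open import Relation.Binary.PropositionalEquality using (_≡_; _≢_)
open import Function.Definitions using (Injective)

-- A graph G ∈ 𝒦_{n,d} is encoded by
--   * an injective σ : Fin d → Fin n : σ t is the t-th stretched
--     original vertex (D(G) = image of σ; stretchings are performed in
--     the order t = 0,1,…,d-1, each vertex at most once by injectivity);
--   * sets A t a (a ∈ Fin 2) of vertices: the sets A_1, A_2 used when
--     stretching σ t.
-- For a stretched vertex i = σ t, the vertex inj₁ i plays the role of the
-- hub i_0 (after the stretching it is a fresh vertex adjacent only to the
-- wings), and inj₂ (t , 0), inj₂ (t , 1) are the wings i_1, i_2.

V : ℕ → ℕ → Set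
V n d = Fin n ⊎ (Fin d × Fin 2)

hub : ∀ {n d} → Fin n → V n d
hub i = inj₁ i

wing : ∀ {n d} → Fin d → Fin 2 → V n d
wing t a = inj₂ (t Data.Product., a)

module Stretch {n d : ℕ} (σ : Fin d → Fin n) (A : Fin d → Fin 2 → V n d → Set) where

  IsHub : ℕ → V n d → Set
  IsHub k (inj₁ i) = Σ (Fin d) λ t → (toℕ t ≡ k) × (σ t ≡ i)
  IsHub k (inj₂ _) = ⊥

  IsWing : ℕ → Fin 2 → V n d → Set
  IsWing k a (inj₁ _) = ⊥
  IsWing k a (inj₂ (t Data.Product., b)) = (toℕ t ≡ k) × (b ≡ a)

  WingToA : ℕ → V n d → V n d → Set
  WingToA k (inj₁ _) v = ⊥
  WingToA k (inj₂ (t Data.Product., a)) v = (toℕ t ≡ k) × A t a v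

  Touched : ℕ → V n d → Set
  Touched k u = IsHub k u ⊎ (Σ (Fin 2) λ a → IsWing k a u)

  NewEdge : ℕ → V n d → V n d → Set
  NewEdge k u v =
      (IsHub k u × Σ (Fin 2) λ a → IsWing k a v)
    ⊎ ((Σ (Fin 2) λ a → IsWing k a u) × IsHub k v)
    ⊎ WingToA k u v
    ⊎ WingToA k v u

  E : ℕ → V n d → V n d → Set
  E zero (inj₁ i) (inj₁ j) = i ≢ j
  E zero (inj₁ _) (inj₂ _) = ⊥
  E zero (inj₂ _) _ = ⊥
  E (suc k) u v = NewEdge k u v ⊎ (¬ Touched k u × ¬ Touched k v × E k u v)

  Admissible : Set
  Admissible =
      (∀ t a v → A t a v → E (toℕ t) (inj₁ (σ t)) v)
    × (∀ t v → E (toℕ t) (inj₁ (σ t)) v → A t Data.Fin.zero v ⊎ A t (Data.Fin.suc Data.Fin.zero) v)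

  EG : V n d → V n d → Set
  EG = E d

sumFin : (m : ℕ) → (Fin m → ℚ) → ℚ
sumFin zero f = 0ℚ
sumFin (suc m) f = f Data.Fin.zero + sumFin m (λ i → f (Data.Fin.suc i))

sumV : (n d : ℕ) → (V n d → ℚ) → ℚ
sumV n d f = sumFin n (λ i → f (inj₁ i))
           + sumFin d (λ t → f (wing t Data.Fin.zero) + f (wing t (Data.Fin.suc Data.Fin.zero)))

ℤtoℚ : ℤ → ℚ
ℤtoℚ z = z / 1

dot : (n d : ℕ) → (V n d → ℤ) → (V n d → ℚ) → ℚ
dot n d a x = sumV n d (λ v → ℤtoℚ (a v) * x v)

Region : ℕ → ℕ → Set₁
Region n d = (V n d → ℚ) → Set

Valid : (n d : ℕ) → (V n d → ℤ) → ℚ → Region n d → Set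
Valid n d a β P = ∀ x → P x → dot n d a x ≤ β

CG : (n d : ℕ) → Region n d → Region n d
CG n d P x = ∀ (a : V n d → ℤ) (β : ℚ) → Valid n d a β P → dot n d a x ≤ ℤtoℚ (floor β)

CG^ : (n d : ℕ) → ℕ → Region n d → Region n d
CG^ n d zero P = P
CG^ n d (suc ℓ) P = CG n d (CG^ n d ℓ P)

FRAC : (n d : ℕ) → (V n d → V n d → Set) → Region n d
FRAC n d E x = (∀ v → (0ℚ ≤ x v) × (x v ≤ 1ℚ)) × (∀ u v → E u v → x u + x v ≤ 1ℚ)

ones : (n d : ℕ) → V n d → ℤ
ones n d _ = ℤ.pos 1
  where open Data.Integer

{-# OPTIONS --safe #-}
module Submission where

-- Let z be the incidence vector of the d hubs, and let δ₀ = e_u for an unstretched original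
-- vertex u and δ_{t+1} = e_{t,1} + e_{t,2} - e_{hub t}.  Then z and every z + δᵢ are incidence
-- vectors of stable sets, and y_c = z + c·Σᵢ δᵢ has only entries 0 and ½ at c = ½, so it lies
-- in FRAC(G).  One Chvátal–Gomory round takes y_c to y_{c/2}: for a valid a·x ≤ β with integral
-- a, either a·Σδ ≤ 0, or some a·δᵢ ≥ 1, and then averaging a·z + 1 ≤ ⌊β⌋ with
-- a·z + c·a·Σδ ≤ β < ⌊β⌋ + 1 gives a·y_{c/2} < ⌊β⌋.  Hence y_{2^-(ℓ+1)} ∈ CG^ℓ(FRAC(G)), where
-- the all-ones inequality reads d + (d+1)/2^(ℓ+1) ≤ d + 1, i.e. d + 1 ≤ 2^(ℓ+1), which gives
-- 3d - 1 ≤ 2·4^ℓ.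

open import Defs
open import Data.Nat.Base using (ℕ)
open import Data.Fin.Base using (Fin)
open import Function.Definitions using (Injective)
open import Relation.Binary.PropositionalEquality using (_≡_; _≢_; refl; sym; trans; cong; cong₂; subst; subst₂)

module RationalArithmetic where

  open import Data.Rational using (1ℚ; ½; _+_; _*_; -_; _≤_; _<_)
  import Data.Rational.Properties as ℚP
  open import Data.Rational.Solver using (module +-*-Solver)
  open +-*-Solver using (solve; _:+_; _:*_; :-_; con; _:=_)

  +-cancelˡ-≤ : ∀ p {q r} → p + q ≤ p + r → q ≤ r
  +-cancelˡ-≤ p {q} {r} p+q≤p+r = subst₂ _≤_ (cancel q) (cancel r) (ℚP.+-monoʳ-≤ (- p) p+q≤p+r)
    where
    cancel : ∀ q → - p + (p + q) ≡ q
    cancel q = solve 2 (λ p q → :- p :+ (p :+ q) := q) refl p q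

  -- 2(m + x/2) = (m + 1) + (m + x) - 1 < F + (F + 1) - 1 = 2F
  midpoint-below : ∀ {m x F} → m + 1ℚ ≤ F → m + x < F + 1ℚ → m + ½ * x < F
  midpoint-below {m} {x} {F} m+1≤F m+x<F+1 =
    subst₂ _<_ (solve 3 (λ m x F → con ½ :* ((m :+ con 1ℚ) :+ (m :+ x)) :+ :- con ½ := m :+ con ½ :* x) refl m x F)
               (solve 1 (λ F → con ½ :* (F :+ (F :+ con 1ℚ)) :+ :- con ½ := F) refl F)
               (ℚP.+-monoˡ-< (- ½) (ℚP.*-monoʳ-<-pos ½ (ℚP.+-mono-≤-< m+1≤F m+x<F+1)))

module Integrality where

  open import Data.Nat.Base as ℕ using (zero; suc)
  import Data.Nat.Coprimality as Coprime
  open import Data.Integer as ℤ using (ℤ; +_; -[1+_]; +≤+)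
  import Data.Integer.Properties as ℤP
  open import Data.Integer.DivMod using (n<s[n/ℕd]*d; div-pos-is-/ℕ)
  open import Data.Rational
    using (ℚ; mkℚ; 0ℚ; 1ℚ; ½; _+_; _*_; -_; _≤_; _<_; *≤*; *<*; floor; nonNegative)
  open import Data.Rational.Solver using (module +-*-Solver)
  open +-*-Solver using (solve; _:*_; con; _:=_)
  open import Algebra.Definitions.RawSemiring Data.Rational.+-*-rawSemiring using (_^_)
  open import Data.Product using (∃-syntax; _,_)
  open import Relation.Nullary using (yes; no)
  open import Data.Empty using (⊥-elim)
  open import Relation.Binary.PropositionalEquality using (cong₂; subst₂; module ≡-Reasoning)
  import Data.Rational.Properties as ℚP

  -- ℤtoℚ k = k / 1 is normalised through a gcd computation; its normal form is integer k,
  -- on which the rational operations compute.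
  integer : ℤ → ℚ
  integer k = mkℚ k 0 (Coprime.sym (Coprime.1-coprimeTo _))

  ℤtoℚ-normal : ∀ k → ℤtoℚ k ≡ integer k
  ℤtoℚ-normal k = ℚP.↥p/↧p≡p (integer k)

  ℤtoℚ-+ : ∀ i j → ℤtoℚ (i ℤ.+ j) ≡ ℤtoℚ i + ℤtoℚ j
  ℤtoℚ-+ i j = trans
    (cong ℤtoℚ (cong₂ ℤ._+_ (sym (ℤP.*-identityʳ i)) (sym (ℤP.*-identityʳ j))))
    (sym (cong₂ _+_ (ℤtoℚ-normal i) (ℤtoℚ-normal j)))

  ℤtoℚ-* : ∀ i j → ℤtoℚ (i ℤ.* j) ≡ ℤtoℚ i * ℤtoℚ j
  ℤtoℚ-* i j = sym (cong₂ _*_ (ℤtoℚ-normal i) (ℤtoℚ-normal j))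

  ℤtoℚ-neg : ∀ k → ℤtoℚ (ℤ.- k) ≡ - ℤtoℚ k
  ℤtoℚ-neg k = trans (ℤtoℚ-normal (ℤ.- k)) (trans (normal-neg k) (cong -_ (sym (ℤtoℚ-normal k))))
    where
    normal-neg : ∀ k → integer (ℤ.- k) ≡ - integer k
    normal-neg (+ zero) = refl
    normal-neg (+ suc n) = refl
    normal-neg -[1+ n ] = refl

  ℤtoℚ-suc : ∀ k → ℤtoℚ (ℤ.suc k) ≡ ℤtoℚ k + 1ℚ
  ℤtoℚ-suc k = trans (ℤtoℚ-+ (+ 1) k) (ℚP.+-comm 1ℚ (ℤtoℚ k))

  ℤtoℚ-mono-≤ : ∀ {i j} → i ℤ.≤ j → ℤtoℚ i ≤ ℤtoℚ j
  ℤtoℚ-mono-≤ {i} {j} i≤j = subst₂ _≤_ (sym (ℤtoℚ-normal i)) (sym (ℤtoℚ-normal j))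
    (*≤* (subst₂ ℤ._≤_ (sym (ℤP.*-identityʳ i)) (sym (ℤP.*-identityʳ j)) i≤j))

  ℤtoℚ-cancel-≤ : ∀ {i j} → ℤtoℚ i ≤ ℤtoℚ j → i ℤ.≤ j
  ℤtoℚ-cancel-≤ {i} {j} i≤j with subst₂ _≤_ (ℤtoℚ-normal i) (ℤtoℚ-normal j) i≤j
  ... | *≤* i*1≤j*1 = subst₂ ℤ._≤_ (ℤP.*-identityʳ i) (ℤP.*-identityʳ j) i*1≤j*1

  ℤtoℚ-cancel-< : ∀ {i j} → ℤtoℚ i < ℤtoℚ j → i ℤ.< j
  ℤtoℚ-cancel-< {i} {j} i<j with subst₂ _<_ (ℤtoℚ-normal i) (ℤtoℚ-normal j) i<j
  ... | *<* i*1<j*1 = subst₂ ℤ._<_ (ℤP.*-identityʳ i) (ℤP.*-identityʳ j) i*1<j*1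

  <-floor+1 : ∀ β → β < ℤtoℚ (floor β) + 1ℚ
  <-floor+1 β@(mkℚ p q-1 _) =
    subst (β <_) (trans (sym (ℤtoℚ-normal (ℤ.suc (floor β)))) (ℤtoℚ-suc (floor β))) (*<* p*1<[1+⌊β⌋]*q)
    where
    p*1<[1+⌊β⌋]*q : p ℤ.* + 1 ℤ.< ℤ.suc (floor β) ℤ.* + suc q-1
    p*1<[1+⌊β⌋]*q = subst₂ ℤ._<_ (sym (ℤP.*-identityʳ p))
      (cong (λ f → ℤ.suc f ℤ.* + suc q-1) (sym (div-pos-is-/ℕ p (suc q-1))))
      (n<s[n/ℕd]*d p (suc q-1))

  floor-greatest : ∀ {k} β → ℤtoℚ k ≤ β → k ℤ.≤ floor β
  floor-greatest {k} β k≤β with k ℤ.≤? floor β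
  ... | yes k≤⌊β⌋ = k≤⌊β⌋
  ... | no k≰⌊β⌋ = ⊥-elim (ℚP.<-irrefl refl (ℚP.<-≤-trans β<k k≤β))
    where
    β<k : β < ℤtoℚ k
    β<k = ℚP.<-≤-trans (<-floor+1 β)
      (subst (_≤ ℤtoℚ k) (ℤtoℚ-suc (floor β)) (ℤtoℚ-mono-≤ (ℤP.i<j⇒suc[i]≤j (ℤP.≰⇒> k≰⌊β⌋))))

  Integral : ℚ → Set
  Integral q = ∃[ k ] q ≡ ℤtoℚ k

  Integral-0 : Integral 0ℚ
  Integral-0 = + 0 , refl

  Integral-1 : Integral 1ℚ
  Integral-1 = + 1 , refl

  Integral-+ : ∀ {p q} → Integral p → Integral q → Integral (p + q)
  Integral-+ (i , refl) (j , refl) = i ℤ.+ j , sym (ℤtoℚ-+ i j)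

  Integral-* : ∀ {p q} → Integral p → Integral q → Integral (p * q)
  Integral-* (i , refl) (j , refl) = i ℤ.* j , sym (ℤtoℚ-* i j)

  Integral-neg : ∀ {q} → Integral q → Integral (- q)
  Integral-neg (k , refl) = ℤ.- k , sym (ℤtoℚ-neg k)

  Integral-pos⇒≥1 : ∀ {q} → Integral q → 0ℚ < q → 1ℚ ≤ q
  Integral-pos⇒≥1 (k , refl) 0<k = ℤtoℚ-mono-≤ {+ 1} {k} (ℤP.i<j⇒suc[i]≤j (ℤtoℚ-cancel-< {+ 0} {k} 0<k))

  Integral-≤-floor : ∀ {q} β → Integral q → q ≤ β → q ≤ ℤtoℚ (floor β)
  Integral-≤-floor β (k , refl) k≤β = ℤtoℚ-mono-≤ (floor-greatest {k} β k≤β)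

  2^k*½^k≡1 : ∀ k → ℤtoℚ (+ (2 ℕ.^ k)) * ½ ^ k ≡ 1ℚ
  2^k*½^k≡1 zero = refl
  2^k*½^k≡1 (suc k) = begin
    ℤtoℚ (+ (2 ℕ.* 2 ℕ.^ k)) * (½ * ½ ^ k)
      ≡⟨ cong (λ z → ℤtoℚ z * (½ * ½ ^ k)) (ℤP.pos-* 2 (2 ℕ.^ k)) ⟩
    ℤtoℚ (+ 2 ℤ.* + (2 ℕ.^ k)) * (½ * ½ ^ k)
      ≡⟨ cong (_* (½ * ½ ^ k)) (ℤtoℚ-* (+ 2) (+ (2 ℕ.^ k))) ⟩
    ℤtoℚ (+ 2) * ℤtoℚ (+ (2 ℕ.^ k)) * (½ * ½ ^ k)
      ≡⟨ solve 2 (λ p h → con (ℤtoℚ (+ 2)) :* p :* (con ½ :* h) := p :* h) refl (ℤtoℚ (+ (2 ℕ.^ k))) (½ ^ k) ⟩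
    ℤtoℚ (+ (2 ℕ.^ k)) * ½ ^ k
      ≡⟨ 2^k*½^k≡1 k ⟩
    1ℚ ∎
    where open ≡-Reasoning

  ½^k*N≤1⇒N≤2^k : ∀ k N → ½ ^ k * ℤtoℚ (+ N) ≤ 1ℚ → N ℕ.≤ 2 ℕ.^ k
  ½^k*N≤1⇒N≤2^k k N ½^k*N≤1 = ℤP.drop‿+≤+ (ℤtoℚ-cancel-≤ (begin
    ℤtoℚ (+ N)                   ≡⟨ sym (ℚP.*-identityˡ (ℤtoℚ (+ N))) ⟩
    1ℚ * ℤtoℚ (+ N)              ≡⟨ cong (_* ℤtoℚ (+ N)) (sym (2^k*½^k≡1 k)) ⟩
    2^k * ½ ^ k * ℤtoℚ (+ N)     ≡⟨ ℚP.*-assoc 2^k (½ ^ k) (ℤtoℚ (+ N)) ⟩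
    2^k * (½ ^ k * ℤtoℚ (+ N))   ≤⟨ ℚP.*-monoˡ-≤-nonNeg 2^k ½^k*N≤1 ⟩
    2^k * 1ℚ                     ≡⟨ ℚP.*-identityʳ 2^k ⟩
    2^k                          ∎))
    where
    open ℚP.≤-Reasoning
    2^k : ℚ
    2^k = ℤtoℚ (+ (2 ℕ.^ k))
    instance _ = nonNegative (ℤtoℚ-mono-≤ {+ 0} {+ (2 ℕ.^ k)} (+≤+ ℕ.z≤n))

module Summation where

  open import Data.Nat.Base using (zero; suc)
  open import Data.Fin using (Fin; zero; suc)
  open import Data.Fin.Properties using (punchInᵢ≢i)
  import Data.Integer as ℤ
  open import Data.Rational using (ℚ; 0ℚ; 1ℚ; _+_; _<_)
  import Data.Rational.Properties as ℚP
  open import Algebra.Bundles using (CommutativeRing)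
  open import Algebra.Properties.Semiring.Sum (CommutativeRing.semiring ℚP.+-*-commutativeRing)
  open import Data.Product using (∃-syntax; _,_)
  open import Data.Empty using (⊥-elim)
  open import Function using (_∘_)
  open import Data.Vec.Functional using (removeAt)
  open import Relation.Nullary using (yes; no)
  open import Relation.Binary.PropositionalEquality
  open Integrality

  sumFin≡sum : ∀ m (f : Fin m → ℚ) → sumFin m f ≡ sum f
  sumFin≡sum zero f = refl
  sumFin≡sum (suc m) f = cong (f zero +_) (sumFin≡sum m (f ∘ suc))

  sum-zeros : ∀ {m} (f : Fin m → ℚ) → (∀ i → f i ≡ 0ℚ) → sum f ≡ 0ℚ
  sum-zeros {m} f f≗0 = trans (sum-cong-≗ f≗0) (sum-replicate-zero m)

  sum-single : ∀ {m} (f : Fin m → ℚ) j → (∀ i → i ≢ j → f i ≡ 0ℚ) → sum f ≡ f j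
  sum-single {suc m} f j vanish = begin
    sum f                      ≡⟨ sum-remove {i = j} f ⟩
    f j + sum (removeAt f j)   ≡⟨ cong (f j +_) (sum-zeros _ (λ i → vanish _ (punchInᵢ≢i j i))) ⟩
    f j + 0ℚ                   ≡⟨ ℚP.+-identityʳ (f j) ⟩
    f j                        ∎
    where open ≡-Reasoning

  sum-ones : ∀ m → sum {m} (λ _ → 1ℚ) ≡ ℤtoℚ (ℤ.+ m)
  sum-ones zero = refl
  sum-ones (suc m) = trans (cong (1ℚ +_) (sum-ones m)) (sym (ℤtoℚ-+ (ℤ.+ 1) (ℤ.+ m)))

  Integral-sum : ∀ {m} (f : Fin m → ℚ) → (∀ i → Integral (f i)) → Integral (sum f)
  Integral-sum {zero} f _ = Integral-0
  Integral-sum {suc m} f int = Integral-+ (int zero) (Integral-sum (f ∘ suc) (int ∘ suc))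

  sum-pos⇒pos : ∀ {m} (f : Fin m → ℚ) → 0ℚ < sum f → ∃[ i ] 0ℚ < f i
  sum-pos⇒pos {zero} f 0<0 = ⊥-elim (ℚP.<-irrefl refl 0<0)
  sum-pos⇒pos {suc m} f 0<sum with 0ℚ ℚP.<? f zero | 0ℚ ℚP.<? sum (f ∘ suc)
  ... | yes 0<f₀ | _ = zero , 0<f₀
  ... | no _ | yes 0<rest = let i , 0<fᵢ = sum-pos⇒pos (f ∘ suc) 0<rest in suc i , 0<fᵢ
  ... | no f₀≮0 | no rest≮0 = ⊥-elim (ℚP.<-irrefl refl
    (ℚP.<-≤-trans 0<sum (ℚP.+-mono-≤ (ℚP.≮⇒≥ f₀≮0) (ℚP.≮⇒≥ rest≮0))))

module DotProduct {n d : ℕ} where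

  open import Data.Nat.Base using (zero; suc)
  open import Data.Fin using (Fin; zero; suc)
  open import Data.Sum using (inj₁; inj₂)
  open import Data.Product using (_,_)
  open import Data.Rational using (ℚ; 0ℚ; 1ℚ; _+_; _*_)
  import Data.Rational.Properties as ℚP
  open import Algebra.Bundles using (CommutativeRing; CommutativeMonoid)
  open import Algebra.Properties.Semiring.Sum (CommutativeRing.semiring ℚP.+-*-commutativeRing)
  open import Algebra.Properties.CommutativeSemigroup
    (CommutativeMonoid.commutativeSemigroup ℚP.+-0-commutativeMonoid) using (interchange)
  open import Algebra.Properties.CommutativeSemigroup
    (CommutativeMonoid.commutativeSemigroup ℚP.*-1-commutativeMonoid) using (x∙yz≈y∙xz)
  open import Data.Sum.Properties using (inj₁-injective; inj₂-injective)
  open import Data.Product.Properties using (,-injectiveˡ; ,-injectiveʳ)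
  import Data.Fin.Properties as Fin
  import Data.Sum.Properties as ⊎
  import Data.Product.Properties as ×
  open import Data.Bool using (if_then_else_)
  open import Data.Empty using (⊥-elim)
  open import Relation.Nullary using (yes; no; does)
  open import Relation.Binary.Definitions using (DecidableEquality)
  open import Function using (_∘_)
  open import Relation.Binary.PropositionalEquality
  open ≡-Reasoning
  open Integrality
  open Summation

  Point : Set
  Point = V n d → ℚ

  private
    pair : Point → Fin d → ℚ
    pair x t = x (wing t zero) + x (wing t (suc zero))

  sumV-split : ∀ (x : Point) → sumV n d x ≡ sum (x ∘ hub) + sum (pair x)
  sumV-split x = cong₂ _+_ (sumFin≡sum n (x ∘ hub)) (sumFin≡sum d (pair x))

  sumV-+ : ∀ (x y : Point) → sumV n d (λ v → x v + y v) ≡ sumV n d x + sumV n d y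
  sumV-+ x y = begin
    sumV n d (λ v → x v + y v)
      ≡⟨ sumV-split (λ v → x v + y v) ⟩
    sum (λ i → x (hub i) + y (hub i)) + sum (pair (λ v → x v + y v))
      ≡⟨ cong (sum (λ i → x (hub i) + y (hub i)) +_) (sum-cong-≗ (λ t →
           interchange (x (wing t zero)) (y (wing t zero)) (x (wing t (suc zero))) (y (wing t (suc zero))))) ⟩
    sum (λ i → x (hub i) + y (hub i)) + sum (λ t → pair x t + pair y t)
      ≡⟨ cong₂ _+_ (∑-distrib-+ (x ∘ hub) (y ∘ hub)) (∑-distrib-+ (pair x) (pair y)) ⟩
    (sum (x ∘ hub) + sum (y ∘ hub)) + (sum (pair x) + sum (pair y))
      ≡⟨ interchange (sum (x ∘ hub)) (sum (y ∘ hub)) (sum (pair x)) (sum (pair y)) ⟩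
    (sum (x ∘ hub) + sum (pair x)) + (sum (y ∘ hub) + sum (pair y))
      ≡⟨ sym (cong₂ _+_ (sumV-split x) (sumV-split y)) ⟩
    sumV n d x + sumV n d y ∎

  sumV-* : ∀ c (x : Point) → sumV n d (λ v → c * x v) ≡ c * sumV n d x
  sumV-* c x = begin
    sumV n d (λ v → c * x v)
      ≡⟨ sumV-split (λ v → c * x v) ⟩
    sum (λ i → c * x (hub i)) + sum (λ t → c * x (wing t zero) + c * x (wing t (suc zero)))
      ≡⟨ cong (sum (λ i → c * x (hub i)) +_)
              (sum-cong-≗ (λ t → sym (ℚP.*-distribˡ-+ c (x (wing t zero)) (x (wing t (suc zero)))))) ⟩
    sum (λ i → c * x (hub i)) + sum (λ t → c * pair x t)
      ≡⟨ sym (cong₂ _+_ (*-distribˡ-sum c (x ∘ hub)) (*-distribˡ-sum c (pair x))) ⟩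
    c * sum (x ∘ hub) + c * sum (pair x)
      ≡⟨ sym (ℚP.*-distribˡ-+ c (sum (x ∘ hub)) (sum (pair x))) ⟩
    c * (sum (x ∘ hub) + sum (pair x))
      ≡⟨ sym (cong (c *_) (sumV-split x)) ⟩
    c * sumV n d x ∎

  sumV-zeros : sumV n d (λ _ → 0ℚ) ≡ 0ℚ
  sumV-zeros = trans (sumV-split (λ _ → 0ℚ))
    (cong₂ _+_ (sum-zeros {n} (λ _ → 0ℚ) (λ _ → refl)) (sum-zeros (pair (λ _ → 0ℚ)) (λ _ → refl)))

  sumV-sum : ∀ {m} (x : Fin m → Point) → sumV n d (λ v → sum (λ i → x i v)) ≡ sum (λ i → sumV n d (x i))
  sumV-sum {zero} x = sumV-zeros
  sumV-sum {suc m} x =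
    trans (sumV-+ (x zero) (λ v → sum (λ i → x (suc i) v))) (cong (sumV n d (x zero) +_) (sumV-sum (x ∘ suc)))

  sumV-cong : ∀ {x y : Point} → (∀ v → x v ≡ y v) → sumV n d x ≡ sumV n d y
  sumV-cong {x} {y} x≗y = begin
    sumV n d x                      ≡⟨ sumV-split x ⟩
    sum (x ∘ hub) + sum (pair x)    ≡⟨ cong₂ _+_ (sum-cong-≗ (x≗y ∘ hub))
                                                 (sum-cong-≗ (λ t → cong₂ _+_ (x≗y (wing t zero)) (x≗y (wing t (suc zero))))) ⟩
    sum (y ∘ hub) + sum (pair y)    ≡⟨ sym (sumV-split y) ⟩
    sumV n d y                      ∎

  sumV-single : ∀ (x : Point) v → (∀ w → w ≢ v → x w ≡ 0ℚ) → sumV n d x ≡ x v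
  sumV-single x (inj₁ i) vanish = begin
    sumV n d x                      ≡⟨ sumV-split x ⟩
    sum (x ∘ hub) + sum (pair x)    ≡⟨ cong₂ _+_ (sum-single (x ∘ hub) i (λ j j≢i → vanish (hub j) (j≢i ∘ inj₁-injective)))
                                                 (sum-zeros (pair x) (λ t → cong₂ _+_ (vanish _ (λ ())) (vanish _ (λ ())))) ⟩
    x (hub i) + 0ℚ                  ≡⟨ ℚP.+-identityʳ (x (hub i)) ⟩
    x (hub i)                       ∎
  sumV-single x (inj₂ (t , b)) vanish = begin
    sumV n d x                      ≡⟨ sumV-split x ⟩
    sum (x ∘ hub) + sum (pair x)    ≡⟨ cong₂ _+_ (sum-zeros (x ∘ hub) (λ i → vanish (hub i) (λ ())))
                                                 (sum-single (pair x) t (λ s s≢t → cong₂ _+_ (vanish (wing s zero) (other s≢t))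
                                                                                             (vanish (wing s (suc zero)) (other s≢t)))) ⟩
    0ℚ + pair x t                   ≡⟨ ℚP.+-identityˡ (pair x t) ⟩
    pair x t                        ≡⟨ pair-at b (λ c c≢b → vanish (wing t c) (c≢b ∘ ,-injectiveʳ ∘ inj₂-injective)) ⟩
    x (wing t b)                    ∎
    where
    other : ∀ {s a} → s ≢ t → wing {n} s a ≢ wing t b
    other s≢t = s≢t ∘ ,-injectiveˡ ∘ inj₂-injective
    pair-at : ∀ b → (∀ c → c ≢ b → x (wing t c) ≡ 0ℚ) → pair x t ≡ x (wing t b)
    pair-at zero vanish′ =
      trans (cong (x (wing t zero) +_) (vanish′ (suc zero) (λ ()))) (ℚP.+-identityʳ (x (wing t zero)))
    pair-at (suc zero) vanish′ =
      trans (cong (_+ x (wing t (suc zero))) (vanish′ zero (λ ()))) (ℚP.+-identityˡ (x (wing t (suc zero))))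

  dot-+ : ∀ a (x y : Point) → dot n d a (λ v → x v + y v) ≡ dot n d a x + dot n d a y
  dot-+ a x y = trans (sumV-cong (λ v → ℚP.*-distribˡ-+ (ℤtoℚ (a v)) (x v) (y v)))
                      (sumV-+ (λ v → ℤtoℚ (a v) * x v) (λ v → ℤtoℚ (a v) * y v))

  dot-* : ∀ a c (x : Point) → dot n d a (λ v → c * x v) ≡ c * dot n d a x
  dot-* a c x = trans (sumV-cong (λ v → x∙yz≈y∙xz (ℤtoℚ (a v)) c (x v)))
                      (sumV-* c (λ v → ℤtoℚ (a v) * x v))

  dot-sum : ∀ a {m} (x : Fin m → Point) → dot n d a (λ v → sum (λ i → x i v)) ≡ sum (λ i → dot n d a (x i))
  dot-sum a x = trans (sumV-cong (λ v → *-distribˡ-sum (ℤtoℚ (a v)) (λ i → x i v)))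
                      (sumV-sum (λ i v → ℤtoℚ (a v) * x i v))

  IntegralPoint : Point → Set
  IntegralPoint x = ∀ v → Integral (x v)

  Integral-dot : ∀ a {x : Point} → IntegralPoint x → Integral (dot n d a x)
  Integral-dot a {x} int = subst Integral (sym (sumV-split (λ v → ℤtoℚ (a v) * x v)))
    (Integral-+ (Integral-sum _ (λ i → Integral-* (a (hub i) , refl) (int (hub i))))
                (Integral-sum _ (λ t → Integral-+ (Integral-* (a (wing t zero) , refl) (int (wing t zero)))
                                                  (Integral-* (a (wing t (suc zero)) , refl) (int (wing t (suc zero)))))))

  _≟V_ : DecidableEquality (V n d)
  _≟V_ = ⊎.≡-dec Fin._≟_ (×.≡-dec Fin._≟_ Fin._≟_)

  unit : V n d → Point
  unit v w = if does (w ≟V v) then 1ℚ else 0ℚ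

  unit-self : ∀ v → unit v v ≡ 1ℚ
  unit-self v with v ≟V v
  ... | yes _ = refl
  ... | no v≢v = ⊥-elim (v≢v refl)

  unit-other : ∀ {v w} → w ≢ v → unit v w ≡ 0ℚ
  unit-other {v} {w} w≢v with w ≟V v
  ... | yes w≡v = ⊥-elim (w≢v w≡v)
  ... | no _ = refl

  unit-integral : ∀ v → IntegralPoint (unit v)
  unit-integral v w with w ≟V v
  ... | yes _ = Integral-1
  ... | no _ = Integral-0

  dot-unit : ∀ a v → dot n d a (unit v) ≡ ℤtoℚ (a v)
  dot-unit a v = begin
    dot n d a (unit v)           ≡⟨ sumV-single (λ w → ℤtoℚ (a w) * unit v w) v
                                      (λ w w≢v → trans (cong (ℤtoℚ (a w) *_) (unit-other w≢v)) (ℚP.*-zeroʳ (ℤtoℚ (a w)))) ⟩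
    ℤtoℚ (a v) * unit v v        ≡⟨ cong (ℤtoℚ (a v) *_) (unit-self v) ⟩
    ℤtoℚ (a v) * 1ℚ              ≡⟨ ℚP.*-identityʳ (ℤtoℚ (a v)) ⟩
    ℤtoℚ (a v)                   ∎

module FractionalPoints {n d : ℕ} where

  open import Data.Rational using (ℚ; 0ℚ; 1ℚ; ½; _+_; _≤_)
  import Data.Rational.Properties as ℚP
  open import Data.Sum using (_⊎_; inj₁; inj₂)
  open import Data.Product using (_×_; _,_)
  open import Data.Empty using (⊥; ⊥-elim)
  open import Relation.Nullary.Decidable using (from-yes)
  open DotProduct {n} {d} using (Point)

  private
    0≤1 : 0ℚ ≤ 1ℚ
    0≤1 = from-yes (0ℚ ℚP.≤? 1ℚ)
    0≤½ : 0ℚ ≤ ½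
    0≤½ = from-yes (0ℚ ℚP.≤? ½)
    ½≤1 : ½ ≤ 1ℚ
    ½≤1 = from-yes (½ ℚP.≤? 1ℚ)

  SubIndicatorAt : ℚ → Set → Set
  SubIndicatorAt q S = (q ≡ 0ℚ) ⊎ (q ≡ 1ℚ × S)

  SubIndicator : Point → (V n d → Set) → Set
  SubIndicator x S = ∀ v → SubIndicatorAt (x v) (S v)

  Independent : (V n d → V n d → Set) → (V n d → Set) → Set
  Independent E S = ∀ {v w} → E v w → S v → S w → ⊥

  FRAC-subIndicator : ∀ E {x S} → SubIndicator x S → Independent E S → FRAC n d E x
  FRAC-subIndicator E {x} x⊆S S-independent = bounds , edges
    where
    bounds : ∀ v → (0ℚ ≤ x v) × (x v ≤ 1ℚ)
    bounds v with x⊆S v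
    ... | inj₁ x≡0 rewrite x≡0 = ℚP.≤-refl , 0≤1
    ... | inj₂ (x≡1 , _) rewrite x≡1 = 0≤1 , ℚP.≤-refl
    edges : ∀ v w → E v w → x v + x w ≤ 1ℚ
    edges v w e with x⊆S v | x⊆S w
    ... | inj₁ xv≡0 | inj₁ xw≡0 rewrite xv≡0 | xw≡0 = 0≤1
    ... | inj₁ xv≡0 | inj₂ (xw≡1 , _) rewrite xv≡0 | xw≡1 = ℚP.≤-refl
    ... | inj₂ (xv≡1 , _) | inj₁ xw≡0 rewrite xv≡1 | xw≡0 = ℚP.≤-refl
    ... | inj₂ (_ , Sv) | inj₂ (_ , Sw) = ⊥-elim (S-independent e Sv Sw)

  FRAC-half-integral : ∀ E {x} → (∀ v → x v ≡ 0ℚ ⊎ x v ≡ ½) → FRAC n d E x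
  FRAC-half-integral E {x} x∈0½ = bounds , edges
    where
    bounds : ∀ v → (0ℚ ≤ x v) × (x v ≤ 1ℚ)
    bounds v with x∈0½ v
    ... | inj₁ x≡0 rewrite x≡0 = ℚP.≤-refl , 0≤1
    ... | inj₂ x≡½ rewrite x≡½ = 0≤½ , ½≤1
    edges : ∀ v w → E v w → x v + x w ≤ 1ℚ
    edges v w _ with x∈0½ v | x∈0½ w
    ... | inj₁ xv≡0 | inj₁ xw≡0 rewrite xv≡0 | xw≡0 = 0≤1
    ... | inj₁ xv≡0 | inj₂ xw≡½ rewrite xv≡0 | xw≡½ = ½≤1
    ... | inj₂ xv≡½ | inj₁ xw≡0 rewrite xv≡½ | xw≡0 = ½≤1
    ... | inj₂ xv≡½ | inj₂ xw≡½ rewrite xv≡½ | xw≡½ = ℚP.≤-refl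

module ChvátalGomory {n d : ℕ} where

  open import Data.Nat.Base using (zero; suc)
  open import Data.Fin using (Fin)
  open import Data.Rational using (ℚ; 0ℚ; 1ℚ; ½; _+_; _*_; _≤_; _<_; floor; nonNegative)
  import Data.Rational.Properties as ℚP
  open import Algebra.Bundles using (CommutativeRing)
  open import Algebra.Properties.Semiring.Sum (CommutativeRing.semiring ℚP.+-*-commutativeRing)
    using (sum)
  open import Algebra.Definitions.RawSemiring Data.Rational.+-*-rawSemiring using (_^_)
  open import Data.Product using (_,_)
  open import Relation.Nullary using (yes; no)
  open import Relation.Binary.PropositionalEquality
  open RationalArithmetic
  open Integrality
  open Summation
  open DotProduct {n} {d}

  halving-bound : ∀ {k} {m c β} (g : Fin k → ℚ) → Integral m → (∀ i → Integral (g i)) → 0ℚ ≤ c →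
                  m ≤ β → (∀ i → m + g i ≤ β) → m + c * sum g ≤ β → m + (½ * c) * sum g ≤ ℤtoℚ (floor β)
  halving-bound {m = m} {c} {β} g int-m int-g 0≤c m≤β m+g≤β m+cG≤β with sum g ℚP.≤? 0ℚ
  ... | yes G≤0 = ℚP.≤-trans (ℚP.≤-trans (ℚP.+-monoʳ-≤ m ½cG≤0) (ℚP.≤-reflexive (ℚP.+-identityʳ m)))
                             (Integral-≤-floor β int-m m≤β)
    where
    instance _ = nonNegative (ℚP.*-monoˡ-≤-nonNeg ½ 0≤c)
    ½cG≤0 : (½ * c) * sum g ≤ 0ℚ
    ½cG≤0 = ℚP.≤-trans (ℚP.*-monoˡ-≤-nonNeg (½ * c) G≤0) (ℚP.≤-reflexive (ℚP.*-zeroʳ (½ * c)))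
  ... | no G≰0 = ℚP.<⇒≤ (subst (_< ℤtoℚ (floor β)) (cong (m +_) (sym (ℚP.*-assoc ½ c (sum g))))
                          (midpoint-below {m} {c * sum g} m+1≤⌊β⌋ (ℚP.≤-<-trans m+cG≤β (<-floor+1 β))))
    where
    m+1≤⌊β⌋ : m + 1ℚ ≤ ℤtoℚ (floor β)
    m+1≤⌊β⌋ with sum-pos⇒pos g (ℚP.≰⇒> G≰0)
    ... | i , 0<gᵢ = ℚP.≤-trans (ℚP.+-monoʳ-≤ m (Integral-pos⇒≥1 (int-g i) 0<gᵢ))
                                (Integral-≤-floor β (Integral-+ int-m (int-g i)) (m+g≤β i))

  ray : Point → ∀ {k} → (Fin k → Point) → ℚ → Point
  ray z δ c v = z v + c * sum (λ i → δ i v)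

  dot-ray : ∀ a z {k} (δ : Fin k → Point) c →
            dot n d a (ray z δ c) ≡ dot n d a z + c * sum (λ i → dot n d a (δ i))
  dot-ray a z δ c =
    trans (dot-+ a z (λ v → c * sum (λ i → δ i v)))
          (cong (dot n d a z +_) (trans (dot-* a c (λ v → sum (λ i → δ i v))) (cong (c *_) (dot-sum a δ))))

  CG-integral : ∀ (P : Region n d) {x} → IntegralPoint x → P x → CG n d P x
  CG-integral P int Px a β valid = Integral-≤-floor β (Integral-dot a int) (valid _ Px)

  CG^-integral : ∀ ℓ (P : Region n d) {x} → IntegralPoint x → P x → CG^ n d ℓ P x
  CG^-integral zero P int Px = Px
  CG^-integral (suc ℓ) P int Px = CG-integral (CG^ n d ℓ P) int (CG^-integral ℓ P int Px)

  CG-halving : ∀ (P : Region n d) {z k} {δ : Fin k → Point} {c} → 0ℚ ≤ c →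
               IntegralPoint z → (∀ i → IntegralPoint (δ i)) →
               P z → (∀ i → P (λ v → z v + δ i v)) → P (ray z δ c) →
               CG n d P (ray z δ (½ * c))
  CG-halving P {z} {δ = δ} {c} 0≤c int-z int-δ Pz Pzδ Pray a β valid =
    subst (_≤ ℤtoℚ (floor β)) (sym (dot-ray a z δ (½ * c)))
      (halving-bound (λ i → dot n d a (δ i)) (Integral-dot a int-z) (λ i → Integral-dot a (int-δ i)) 0≤c
        (valid z Pz)
        (λ i → subst (_≤ β) (dot-+ a z (δ i)) (valid _ (Pzδ i)))
        (subst (_≤ β) (dot-ray a z δ c) (valid _ Pray)))

  CG^-ray : ∀ (P : Region n d) {z k} {δ : Fin k → Point} →
            IntegralPoint z → (∀ i → IntegralPoint (δ i)) →
            P z → (∀ i → P (λ v → z v + δ i v)) → P (ray z δ ½) →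
            ∀ ℓ → CG^ n d ℓ P (ray z δ (½ ^ suc ℓ))
  CG^-ray P int-z int-δ Pz Pzδ Pray zero = Pray
  CG^-ray P int-z int-δ Pz Pzδ Pray (suc ℓ) =
    CG-halving (CG^ n d ℓ P) (½^-nonNeg (suc ℓ)) int-z int-δ
      (CG^-integral ℓ P int-z Pz)
      (λ i → CG^-integral ℓ P (λ v → Integral-+ (int-z v) (int-δ i v)) (Pzδ i))
      (CG^-ray P int-z int-δ Pz Pzδ Pray ℓ)
    where
    ½^-nonNeg : ∀ ℓ → 0ℚ ≤ ½ ^ ℓ
    ½^-nonNeg zero = ℚP.nonNegative⁻¹ 1ℚ
    ½^-nonNeg (suc ℓ) = ℚP.*-monoˡ-≤-nonNeg ½ (½^-nonNeg ℓ)

module StretchedGraph {n d : ℕ} (σ : Fin d → Fin n) (σ-injective : Injective _≡_ _≡_ σ)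
                      (A : Fin d → Fin 2 → V n d → Set) (admissible : Stretch.Admissible σ A) where

  open import Data.Nat.Base using (zero; suc; _<_; s≤s)
  open import Data.Nat.Properties using (m<1+n⇒m<n∨m≡n; m<n⇒m<1+n; ≤-reflexive; <-irrefl)
  open import Data.Fin.Base using (toℕ)
  open import Data.Fin.Properties using (toℕ-injective; toℕ<n)
  open import Data.Sum.Base using (inj₁; inj₂)
  open import Data.Sum.Properties using (inj₁-injective; inj₂-injective)
  open import Data.Product.Base as Product using (_×_; ∃-syntax; _,_; proj₁; proj₂)
  open import Data.Product.Properties using (,-injectiveˡ)
  open import Data.Empty using (⊥-elim)
  open import Function.Base using (_∘_)
  open import Relation.Nullary using (¬_)
  open Stretch σ A

  PossibleNeighbour : ℕ → V n d → V n d → Set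
  PossibleNeighbour k (inj₁ i) y = (∀ t → σ t ≡ i → toℕ t < k → ∃[ b ] y ≡ wing t b) × (inj₁ i ≢ y)
  PossibleNeighbour k (inj₂ (t , a)) y = (toℕ t < k) × (∀ b → y ≢ wing t b)

  private
    Mutual : ℕ → V n d → V n d → Set
    Mutual k x y = PossibleNeighbour k x y × PossibleNeighbour k y x

  possible-in-K : ∀ {x y} → E 0 x y → Mutual 0 x y
  possible-in-K {inj₁ i} {inj₁ j} i≢j =
    ((λ _ _ ()) , i≢j ∘ inj₁-injective) , ((λ _ _ ()) , i≢j ∘ sym ∘ inj₁-injective)

  possible-untouched : ∀ k {x y} → ¬ Touched k x → PossibleNeighbour k x y → PossibleNeighbour (suc k) x y
  possible-untouched k {inj₁ i} untouched (wings-only , no-loop) = wings-only′ , no-loop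
    where
    wings-only′ : ∀ t → σ t ≡ i → toℕ t < suc k → ∃[ b ] _ ≡ wing t b
    wings-only′ t σt≡i t<1+k with m<1+n⇒m<n∨m≡n t<1+k
    ... | inj₁ t<k = wings-only t σt≡i t<k
    ... | inj₂ t≡k = ⊥-elim (untouched (inj₁ (t , t≡k , σt≡i)))
  possible-untouched k {inj₂ _} _ (t<k , no-sibling) = m<n⇒m<1+n t<k , no-sibling

  possible-hub-wing : ∀ k {t s} b → toℕ t ≡ k → toℕ s ≡ k → Mutual (suc k) (hub (σ t)) (wing s b)
  possible-hub-wing k {t} {s} b t≡k s≡k = (own-wing , λ ()) , (s<1+k , λ _ ())
    where
    s<1+k : toℕ s < suc k
    s<1+k = s≤s (≤-reflexive s≡k)
    own-wing : ∀ r → σ r ≡ σ t → toℕ r < suc k → ∃[ c ] wing s b ≡ wing r c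
    own-wing r σr≡σt _ =
      b , cong (λ r′ → wing r′ b) (trans (toℕ-injective (trans s≡k (sym t≡k))) (σ-injective (sym σr≡σt)))

  possible-wing-neighbour : ∀ k {t} a {y} → toℕ t ≡ k → PossibleNeighbour k y (hub (σ t)) →
                            Mutual (suc k) (wing t a) y
  possible-wing-neighbour k {t} a {y} t≡k y~hub = (s≤s (≤-reflexive t≡k) , not-sibling) , lift y y~hub
    where
    not-sibling : ∀ b → y ≢ wing t b
    not-sibling b refl = <-irrefl t≡k (proj₁ y~hub)
    lift : ∀ y → PossibleNeighbour k y (hub (σ t)) → PossibleNeighbour (suc k) y (wing t a)
    lift (inj₁ j) (wings-only , _) = wings-only′ , λ ()
      where
      wings-only′ : ∀ s → σ s ≡ j → toℕ s < suc k → ∃[ b ] wing t a ≡ wing s b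
      wings-only′ s σs≡j s<1+k with m<1+n⇒m<n∨m≡n s<1+k
      ... | inj₁ s<k with wings-only s σs≡j s<k
      ...   | _ , ()
      wings-only′ s σs≡j s<1+k | inj₂ s≡k = a , cong (λ r → wing r a) (toℕ-injective (trans t≡k (sym s≡k)))
    lift (inj₂ (s , b)) (s<k , _) = m<n⇒m<1+n s<k , not-wing-of-s
      where
      not-wing-of-s : ∀ c → wing t a ≢ wing s c
      not-wing-of-s c eq = <-irrefl (trans (cong toℕ (sym (,-injectiveˡ (inj₂-injective eq)))) t≡k) s<k

  possible-A-member : ∀ k → (∀ {x y} → E k x y → Mutual k x y) →
                      ∀ {t a y} → toℕ t ≡ k → A t a y → PossibleNeighbour k y (hub (σ t))
  possible-A-member k possible {t} {a} t≡k A-edge =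
    proj₂ (possible (subst (λ m → E m (hub (σ t)) _) t≡k (proj₁ admissible t a _ A-edge)))

  possible-neighbours : ∀ k {x y} → E k x y → Mutual k x y
  possible-neighbours zero e = possible-in-K e
  possible-neighbours (suc k) (inj₂ (x-untouched , y-untouched , e)) =
    Product.map (possible-untouched k x-untouched) (possible-untouched k y-untouched) (possible-neighbours k e)
  possible-neighbours (suc k) {inj₁ _} {inj₂ (_ , b)} (inj₁ (inj₁ ((_ , t≡k , refl) , _ , s≡k , _))) =
    possible-hub-wing k b t≡k s≡k
  possible-neighbours (suc k) {inj₂ (_ , b)} {inj₁ _} (inj₁ (inj₂ (inj₁ ((_ , s≡k , _) , (_ , t≡k , refl))))) =
    Product.swap (possible-hub-wing k b t≡k s≡k)
  possible-neighbours (suc k) {inj₂ (_ , a)} (inj₁ (inj₂ (inj₂ (inj₁ (t≡k , A-edge))))) =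
    possible-wing-neighbour k a t≡k (possible-A-member k (possible-neighbours k) t≡k A-edge)
  possible-neighbours (suc k) {_} {inj₂ (_ , a)} (inj₁ (inj₂ (inj₂ (inj₂ (t≡k , A-edge))))) =
    Product.swap (possible-wing-neighbour k a t≡k (possible-A-member k (possible-neighbours k) t≡k A-edge))

  hub-neighbour-is-wing : ∀ t {y} → EG (hub (σ t)) y → ∃[ b ] y ≡ wing t b
  hub-neighbour-is-wing t e = proj₁ (proj₁ (possible-neighbours d e)) t refl (toℕ<n t)

  hub-neighbour-is-wing′ : ∀ t {y} → EG y (hub (σ t)) → ∃[ b ] y ≡ wing t b
  hub-neighbour-is-wing′ t e = proj₁ (proj₂ (possible-neighbours d e)) t refl (toℕ<n t)

  sibling-wings-nonadjacent : ∀ t a b → ¬ EG (wing t a) (wing t b)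
  sibling-wings-nonadjacent t a b e = proj₂ (proj₁ (possible-neighbours d e)) b refl

  EG-irreflexive : ∀ x → ¬ EG x x
  EG-irreflexive (inj₁ i) e = proj₂ (proj₁ (possible-neighbours d e)) refl
  EG-irreflexive (inj₂ (t , a)) = sibling-wings-nonadjacent t a a

module Construction {n d : ℕ} (σ : Fin d → Fin n) (σ-injective : Injective _≡_ _≡_ σ)
                    (A : Fin d → Fin 2 → V n d → Set) (admissible : Stretch.Admissible σ A)
                    (u : Fin n) (u-unstretched : ∀ t → σ t ≢ u) where

  import Data.Nat.Base as ℕ
  import Data.Nat.Properties as ℕP
  open import Data.Nat.Base using (zero; suc)
  open import Data.Fin.Base using (zero; suc)
  open import Data.Fin.Properties using (any?; _≟_)
  open import Data.Sum.Base using (_⊎_; inj₁; inj₂)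
  open import Data.Sum.Properties using (inj₁-injective; inj₂-injective)
  open import Data.Product.Base using (∃-syntax; _×_; _,_)
  open import Data.Product.Properties using (,-injectiveˡ)
  open import Data.Integer.Base as ℤ using (+_)
  import Data.Integer.Properties as ℤP
  open import Data.Rational using (ℚ; 0ℚ; 1ℚ; ½; _+_; _*_; -_; _/_)
  import Data.Rational.Properties as ℚP
  open import Algebra.Definitions.RawSemiring Data.Rational.+-*-rawSemiring using (_^_)
  open import Algebra.Bundles using (CommutativeRing)
  open import Algebra.Properties.Semiring.Sum (CommutativeRing.semiring ℚP.+-*-commutativeRing)
    using (sum; sum-cong-≗)
  open import Function.Base using (_∘_)
  open import Relation.Nullary using (Dec; yes; no)
  open Stretch σ A using (EG)
  open StretchedGraph σ σ-injective A admissible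
  open RationalArithmetic
  open Integrality
  open Summation
  open DotProduct {n} {d}
  open FractionalPoints {n} {d}
  open ChvátalGomory {n} {d}

  hubs : Point
  hubs w = sum (λ t → unit (hub (σ t)) w)

  direction : Fin (suc d) → Point
  direction zero = unit (hub u)
  direction (suc t) w = unit (wing t zero) w + unit (wing t (suc zero)) w + (- 1ℚ) * unit (hub (σ t)) w

  data Kind : V n d → Set where
    stretched : ∀ t → Kind (hub (σ t))
    spare : Kind (hub u)
    plain : ∀ {i} → (∀ t → σ t ≢ i) → i ≢ u → Kind (hub i)
    winged : ∀ t b → Kind (wing t b)

  kind : ∀ v → Kind v
  kind (inj₁ i) with any? (λ t → σ t ≟ i)
  ... | yes (t , refl) = stretched t
  ... | no unstretched with i ≟ u
  ...   | yes refl = spare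
  ...   | no i≢u = plain (λ t σt≡i → unstretched (t , σt≡i)) i≢u
  kind (inj₂ (t , b)) = winged t b

  private
    hubs-distinct : ∀ {s t} → s ≢ t → hub {d = d} (σ s) ≢ hub (σ t)
    hubs-distinct s≢t = s≢t ∘ σ-injective ∘ inj₁-injective

    unstretched-hub : ∀ {i} → (∀ t → σ t ≢ i) → ∀ t → hub {d = d} i ≢ hub (σ t)
    unstretched-hub unstretched t = unstretched t ∘ sym ∘ inj₁-injective

    spare-not-stretched : ∀ t → hub {d = d} u ≢ hub (σ t)
    spare-not-stretched = unstretched-hub u-unstretched

    wings-distinct : ∀ {s t : Fin d} {a b} → s ≢ t → wing {n} s a ≢ wing t b
    wings-distinct s≢t = s≢t ∘ ,-injectiveˡ ∘ inj₂-injective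

  hubs-stretched : ∀ s → hubs (hub (σ s)) ≡ 1ℚ
  hubs-stretched s =
    trans (sum-single (λ t → unit (hub (σ t)) (hub (σ s))) s (λ t t≢s → unit-other (hubs-distinct (t≢s ∘ sym))))
          (unit-self (hub (σ s)))

  hubs-elsewhere : ∀ {w} → (∀ t → w ≢ hub (σ t)) → hubs w ≡ 0ℚ
  hubs-elsewhere w≢hubs = sum-zeros _ (λ t → unit-other (w≢hubs t))

  direction-elsewhere : ∀ t {w} → w ≢ wing t zero → w ≢ wing t (suc zero) → w ≢ hub (σ t) → direction (suc t) w ≡ 0ℚ
  direction-elsewhere t w≢w₀ w≢w₁ w≢h =
    cong₂ _+_ (cong₂ _+_ (unit-other w≢w₀) (unit-other w≢w₁)) (cong (- 1ℚ *_) (unit-other w≢h))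

  direction-hub : ∀ t → direction (suc t) (hub (σ t)) ≡ - 1ℚ
  direction-hub t =
    cong₂ _+_ (cong₂ _+_ (unit-other {wing t zero} {hub (σ t)} (λ ())) (unit-other {wing t (suc zero)} {hub (σ t)} (λ ())))
              (cong (- 1ℚ *_) (unit-self (hub (σ t))))

  direction-wing : ∀ t b → direction (suc t) (wing t b) ≡ 1ℚ
  direction-wing t zero =
    cong₂ _+_ (cong₂ _+_ (unit-self (wing t zero)) (unit-other {wing t (suc zero)} {wing t zero} (λ ())))
              (cong (- 1ℚ *_) (unit-other {hub (σ t)} {wing t zero} (λ ())))
  direction-wing t (suc zero) =
    cong₂ _+_ (cong₂ _+_ (unit-other {wing t zero} {wing t (suc zero)} (λ ())) (unit-self (wing t (suc zero))))
              (cong (- 1ℚ *_) (unit-other {hub (σ t)} {wing t (suc zero)} (λ ())))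

  spread : Point
  spread w = sum (λ i → direction i w)

  spread-stretched : ∀ s → spread (hub (σ s)) ≡ - 1ℚ
  spread-stretched s = cong₂ _+_ (unit-other {hub u} {hub (σ s)} (spare-not-stretched s ∘ sym))
    (trans (sum-single (λ t → direction (suc t) (hub (σ s))) s
                       (λ t t≢s → direction-elsewhere t (λ ()) (λ ()) (hubs-distinct (t≢s ∘ sym))))
           (direction-hub s))

  spread-spare : spread (hub u) ≡ 1ℚ
  spread-spare = cong₂ _+_ (unit-self (hub u))
    (sum-zeros (λ t → direction (suc t) (hub u)) (λ t → direction-elsewhere t (λ ()) (λ ()) (spare-not-stretched t)))

  spread-plain : ∀ {i} → (∀ t → σ t ≢ i) → i ≢ u → spread (hub i) ≡ 0ℚ
  spread-plain {i} unstretched i≢u = cong₂ _+_ (unit-other {hub u} {hub i} (i≢u ∘ inj₁-injective))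
    (sum-zeros (λ t → direction (suc t) (hub i)) (λ t → direction-elsewhere t (λ ()) (λ ()) (unstretched-hub unstretched t)))

  spread-wing : ∀ s b → spread (wing s b) ≡ 1ℚ
  spread-wing s b = cong₂ _+_ (unit-other {hub u} {wing s b} (λ ()))
    (trans (sum-single (λ t → direction (suc t) (wing s b)) s
                       (λ t t≢s → direction-elsewhere t (wings-distinct (t≢s ∘ sym)) (wings-distinct (t≢s ∘ sym)) (λ ())))
           (direction-wing s b))

  ray-half-integral : ∀ w → ray hubs direction ½ w ≡ 0ℚ ⊎ ray hubs direction ½ w ≡ ½
  ray-half-integral w with kind w
  ... | stretched s = inj₂ (cong₂ _+_ (hubs-stretched s) (cong (½ *_) (spread-stretched s)))
  ... | spare = inj₂ (cong₂ _+_ (hubs-elsewhere spare-not-stretched) (cong (½ *_) spread-spare))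
  ... | plain unstretched i≢u =
    inj₁ (cong₂ _+_ (hubs-elsewhere (unstretched-hub unstretched)) (cong (½ *_) (spread-plain unstretched i≢u)))
  ... | winged s b = inj₂ (cong₂ _+_ (hubs-elsewhere {wing s b} (λ _ ())) (cong (½ *_) (spread-wing s b)))

  Stretched : V n d → Set
  Stretched w = ∃[ t ] w ≡ hub (σ t)

  corner-support : Fin (suc d) → V n d → Set
  corner-support zero w = Stretched w ⊎ w ≡ hub u
  corner-support (suc t) w = (∃[ s ] s ≢ t × w ≡ hub (σ s)) ⊎ (∃[ b ] w ≡ wing t b)

  hubs-subIndicator : SubIndicator hubs Stretched
  hubs-subIndicator w with kind w
  ... | stretched s = inj₂ (hubs-stretched s , s , refl)
  ... | spare = inj₁ (hubs-elsewhere spare-not-stretched)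
  ... | plain unstretched _ = inj₁ (hubs-elsewhere (unstretched-hub unstretched))
  ... | winged s b = inj₁ (hubs-elsewhere {wing s b} (λ _ ()))

  Stretched-independent : Independent EG Stretched
  Stretched-independent e (s , refl) (t , refl) with hub-neighbour-is-wing s e
  ... | _ , ()

  corner-subIndicator : ∀ i → SubIndicator (λ w → hubs w + direction i w) (corner-support i)
  corner-subIndicator zero w with kind w
  ... | stretched s =
    inj₂ (cong₂ _+_ (hubs-stretched s) (unit-other {hub u} (spare-not-stretched s ∘ sym)) , inj₁ (s , refl))
  ... | spare = inj₂ (cong₂ _+_ (hubs-elsewhere spare-not-stretched) (unit-self (hub u)) , inj₂ refl)
  ... | plain unstretched i≢u =
    inj₁ (cong₂ _+_ (hubs-elsewhere (unstretched-hub unstretched)) (unit-other {hub u} (i≢u ∘ inj₁-injective)))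
  ... | winged s b = inj₁ (cong₂ _+_ (hubs-elsewhere {wing s b} (λ _ ())) (unit-other {hub u} {wing s b} (λ ())))
  corner-subIndicator (suc t) w with kind w
  ... | stretched s with s ≟ t
  ...   | yes refl = inj₁ (cong₂ _+_ (hubs-stretched s) (direction-hub s))
  ...   | no s≢t = inj₂ (cong₂ _+_ (hubs-stretched s) (direction-elsewhere t (λ ()) (λ ()) (hubs-distinct s≢t)) ,
                         inj₁ (s , s≢t , refl))
  corner-subIndicator (suc t) w | spare =
    inj₁ (cong₂ _+_ (hubs-elsewhere spare-not-stretched) (direction-elsewhere t (λ ()) (λ ()) (spare-not-stretched t)))
  corner-subIndicator (suc t) w | plain unstretched _ =
    inj₁ (cong₂ _+_ (hubs-elsewhere (unstretched-hub unstretched))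
                    (direction-elsewhere t (λ ()) (λ ()) (unstretched-hub unstretched t)))
  corner-subIndicator (suc t) w | winged s b = winged-case (s ≟ t)
    where
    winged-case : Dec (s ≡ t) → SubIndicatorAt (hubs (wing s b) + direction (suc t) (wing s b)) (corner-support (suc t) (wing s b))
    winged-case (yes refl) = inj₂ (cong₂ _+_ (hubs-elsewhere {wing s b} (λ _ ())) (direction-wing s b) , inj₂ (b , refl))
    winged-case (no s≢t) = inj₁ (cong₂ _+_ (hubs-elsewhere {wing s b} (λ _ ()))
                                           (direction-elsewhere t (wings-distinct s≢t) (wings-distinct s≢t) (λ ())))

  corner-support-independent : ∀ i → Independent EG (corner-support i)
  corner-support-independent zero e (inj₁ Sv) (inj₁ Sw) = Stretched-independent e Sv Sw
  corner-support-independent zero e (inj₁ (s , refl)) (inj₂ refl) with hub-neighbour-is-wing s e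
  ... | _ , ()
  corner-support-independent zero e (inj₂ refl) (inj₁ (t , refl)) with hub-neighbour-is-wing′ t e
  ... | _ , ()
  corner-support-independent zero e (inj₂ refl) (inj₂ refl) = EG-irreflexive (hub u) e
  corner-support-independent (suc t) e (inj₁ (s , _ , refl)) (inj₁ (s′ , _ , refl)) = Stretched-independent e (s , refl) (s′ , refl)
  corner-support-independent (suc t) e (inj₁ (s , s≢t , refl)) (inj₂ (b , refl)) with hub-neighbour-is-wing s e
  ... | _ , eq = wings-distinct (s≢t ∘ sym) eq
  corner-support-independent (suc t) e (inj₂ (b , refl)) (inj₁ (s , s≢t , refl)) with hub-neighbour-is-wing′ s e
  ... | _ , eq = wings-distinct (s≢t ∘ sym) eq
  corner-support-independent (suc t) e (inj₂ (b , refl)) (inj₂ (c , refl)) = sibling-wings-nonadjacent t b c e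

  hubs-integral : IntegralPoint hubs
  hubs-integral w = Integral-sum _ (λ t → unit-integral (hub (σ t)) w)

  direction-integral : ∀ i → IntegralPoint (direction i)
  direction-integral zero = unit-integral (hub u)
  direction-integral (suc t) w =
    Integral-+ (Integral-+ (unit-integral (wing t zero) w) (unit-integral (wing t (suc zero)) w))
               (Integral-* (Integral-neg Integral-1) (unit-integral (hub (σ t)) w))

  ray-in-CG^ : ∀ ℓ → CG^ n d ℓ (FRAC n d EG) (ray hubs direction (½ ^ suc ℓ))
  ray-in-CG^ = CG^-ray (FRAC n d EG) hubs-integral direction-integral
    (FRAC-subIndicator EG hubs-subIndicator Stretched-independent)
    (λ i → FRAC-subIndicator EG (corner-subIndicator i) (corner-support-independent i))
    (FRAC-half-integral EG ray-half-integral)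

  dot-ones-hubs : dot n d (ones n d) hubs ≡ ℤtoℚ (+ d)
  dot-ones-hubs = trans (dot-sum (ones n d) (λ t → unit (hub (σ t))))
                        (trans (sum-cong-≗ (λ t → dot-unit (ones n d) (hub (σ t)))) (sum-ones d))

  dot-ones-direction : ∀ i → dot n d (ones n d) (direction i) ≡ 1ℚ
  dot-ones-direction zero = dot-unit (ones n d) (hub u)
  dot-ones-direction (suc t) =
    trans (dot-+ (ones n d) (λ w → unit (wing t zero) w + unit (wing t (suc zero)) w) (λ w → - 1ℚ * unit (hub (σ t)) w))
          (cong₂ _+_ (trans (dot-+ (ones n d) (unit (wing t zero)) (unit (wing t (suc zero))))
                            (cong₂ _+_ (dot-unit (ones n d) (wing t zero)) (dot-unit (ones n d) (wing t (suc zero)))))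
                     (trans (dot-* (ones n d) (- 1ℚ) (unit (hub (σ t)))) (cong (- 1ℚ *_) (dot-unit (ones n d) (hub (σ t))))))

  dot-ones-ray : ∀ c → dot n d (ones n d) (ray hubs direction c) ≡ ℤtoℚ (+ d) + c * ℤtoℚ (+ suc d)
  dot-ones-ray c = trans (dot-ray (ones n d) hubs direction c)
    (cong₂ (λ p q → p + c * q) dot-ones-hubs (trans (sum-cong-≗ dot-ones-direction) (sum-ones (suc d))))

  rank-bound : ∀ ℓ → Valid n d (ones n d) (+ (d ℕ.+ 1) / 1) (CG^ n d ℓ (FRAC n d EG)) → d ℕ.+ 1 ℕ.≤ 2 ℕ.^ suc ℓ
  rank-bound ℓ valid = ½^k*N≤1⇒N≤2^k (suc ℓ) (d ℕ.+ 1) (+-cancelˡ-≤ (ℤtoℚ (+ d)) (begin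
    ℤtoℚ (+ d) + c * ℤtoℚ (+ (d ℕ.+ 1))  ≡⟨ cong (λ m → ℤtoℚ (+ d) + c * ℤtoℚ (+ m)) (ℕP.+-comm d 1) ⟩
    ℤtoℚ (+ d) + c * ℤtoℚ (+ suc d)      ≡⟨ sym (dot-ones-ray c) ⟩
    dot n d (ones n d) (ray hubs direction c)  ≤⟨ valid _ (ray-in-CG^ ℓ) ⟩
    ℤtoℚ (+ (d ℕ.+ 1))                   ≡⟨ cong ℤtoℚ (ℤP.pos-+ d 1) ⟩
    ℤtoℚ (+ d ℤ.+ + 1)                    ≡⟨ ℤtoℚ-+ (+ d) (+ 1) ⟩
    ℤtoℚ (+ d) + 1ℚ                       ∎))
    where
    open ℚP.≤-Reasoning
    c : ℚ
    c = ½ ^ suc ℓ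

open import Data.Nat using (zero; suc; _≤_; _<_; _+_; _*_; _∸_; _^_; z≤n; s≤s)
open import Data.Nat.Properties
  using (≤-refl; <⇒≱; <-≤-trans; m<m+n; m≤m+n; +-cancelʳ-≤; ∸-monoˡ-≤; m+n∸n≡m; *-monoʳ-≤; module ≤-Reasoning)
open import Data.Nat.Solver using (module +-*-Solver)
open +-*-Solver using (solve; _:+_; _:*_; con; _:=_)
open import Data.Fin using (zero; suc)
open import Data.Fin.Properties using (_≟_; any?; all?; ¬∀⟶∃¬; injective⇒≤)
open import Data.Integer using (+_)
open import Data.Rational using (_/_)
open import Data.Product using (_×_; ∃-syntax; _,_; proj₁; proj₂)
open import Data.Empty using (⊥-elim)
open import Relation.Nullary using (¬_; yes; no)

unstretched-vertex : ∀ {d n} → d < n → (σ : Fin d → Fin n) → ∃[ u ] ∀ t → σ t ≢ u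
unstretched-vertex {d} {n} d<n σ with all? (λ i → any? (λ t → σ t ≟ i))
... | yes onto = ⊥-elim (<⇒≱ d<n (injective⇒≤ section-injective))
  where
  section-injective : Injective _≡_ _≡_ (λ i → proj₁ (onto i))
  section-injective {i} {j} eq = trans (sym (proj₂ (onto i))) (trans (cong σ eq) (proj₂ (onto j)))
... | no not-onto with ¬∀⟶∃¬ n _ (λ i → any? (λ t → σ t ≟ i)) not-onto
...   | u , u-missed = u , λ t σt≡u → u-missed (t , σt≡u)

4^m≡2^m*2^m : ∀ m → 4 ^ m ≡ 2 ^ m * 2 ^ m
4^m≡2^m*2^m zero = refl
4^m≡2^m*2^m (suc m) = trans (cong (4 *_) (4^m≡2^m*2^m m))
  (solve 1 (λ x → con 4 :* (x :* x) := (con 2 :* x) :* (con 2 :* x)) refl (2 ^ m))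

3*m≤m*m+2 : ∀ m → 3 * m ≤ m * m + 2
3*m≤m*m+2 0 = z≤n
3*m≤m*m+2 1 = ≤-refl
3*m≤m*m+2 2 = ≤-refl
3*m≤m*m+2 (suc (suc (suc k))) = subst (3 * (3 + k) ≤_)
  (solve 1 (λ k → con 3 :* (con 3 :+ k) :+ (k :* k :+ con 3 :* k :+ con 2) := (con 3 :+ k) :* (con 3 :+ k) :+ con 2) refl k)
  (m≤m+n (3 * (3 + k)) (k * k + 3 * k + 2))

3*d∸1≤2*4^ℓ : ∀ d ℓ → d + 1 ≤ 2 ^ suc ℓ → 3 * d ∸ 1 ≤ 2 * 4 ^ ℓ
3*d∸1≤2*4^ℓ d ℓ d+1≤2x = begin
  3 * d ∸ 1             ≤⟨ ∸-monoˡ-≤ 1 (+-cancelʳ-≤ 3 (3 * d) (2 * (x * x) + 1) 3d+3≤2x²+4) ⟩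
  2 * (x * x) + 1 ∸ 1   ≡⟨ m+n∸n≡m (2 * (x * x)) 1 ⟩
  2 * (x * x)           ≡⟨ cong (2 *_) (sym (4^m≡2^m*2^m ℓ)) ⟩
  2 * 4 ^ ℓ             ∎
  where
  open ≤-Reasoning
  x : ℕ
  x = 2 ^ ℓ
  3d+3≤2x²+4 : 3 * d + 3 ≤ 2 * (x * x) + 1 + 3
  3d+3≤2x²+4 = begin
    3 * d + 3            ≡⟨ solve 1 (λ d → con 3 :* d :+ con 3 := con 3 :* (d :+ con 1)) refl d ⟩
    3 * (d + 1)          ≤⟨ *-monoʳ-≤ 3 d+1≤2x ⟩
    3 * (2 * x)          ≡⟨ solve 1 (λ x → con 3 :* (con 2 :* x) := con 2 :* (con 3 :* x)) refl x ⟩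
    2 * (3 * x)          ≤⟨ *-monoʳ-≤ 2 (3*m≤m*m+2 x) ⟩
    2 * (x * x + 2)      ≡⟨ solve 1 (λ x → con 2 :* (x :* x :+ con 2) := con 2 :* (x :* x) :+ con 1 :+ con 3) refl x ⟩
    2 * (x * x) + 1 + 3  ∎

proposition4p10 :
    (n d : ℕ) → 1 ≤ d → d + 2 ≤ n →
    (σ : Fin d → Fin n) → Injective _≡_ _≡_ σ →
    (A : Fin d → Fin 2 → V n d → Set) →
    Stretch.Admissible σ A →
    (∀ s t → s ≢ t →
       ¬ Stretch.EG σ A (wing s zero) (wing t zero)
       × ¬ Stretch.EG σ A (wing s (suc zero)) (wing t (suc zero))) →
    (ℓ : ℕ) →
    Valid n d (ones n d) (+ (d + 1) / 1) (CG^ n d ℓ (FRAC n d (Stretch.EG σ A))) →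
    3 * d ∸ 1 ≤ 2 * 4 ^ ℓ
proposition4p10 n d _ d+2≤n σ σ-injective A admissible _ ℓ valid
  with unstretched-vertex (<-≤-trans (m<m+n d (s≤s z≤n)) d+2≤n) σ
... | u , u-unstretched =
  3*d∸1≤2*4^ℓ d ℓ (Construction.rank-bound σ σ-injective A admissible u u-unstretched ℓ valid)
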